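{- The common dual relation $\sim$ is not transitive on the set of planar graphs: there exist planar graphs $G_1,G_2,G_3$ with $G_1\sim G_2$ and $G_2\sim G_3$ but $G_1\not\sim G_3$.
   Context: Graphs may have multiple edges and loops. For a planar graph $G$ with planar embedding $\mathcal{G}$, the dual of $G$ with respect to $\mathcal{G}$ has one vertex per face of $\mathcal{G}$ and one edge $e^\star$ per edge $e$ of $G$, joining the two faces incident to $e$. The common dual relation $\sim$: for planar graphs $G_1,G_2$, $G_1\sim G_2$ iff there are planar embeddings of $G_1$ and $G_2$ such that the corresponding dual graphs are isomorphic. -}

module Defs where

open import Data.Nat using (ℕ; zero; suc; _+_)
open import Data.Fin using (Fin)
open import Data.Bool using (Bool; true; false; not)
open import Data.Product using (Σ; ∃; _×_; _,_; proj₁; proj₂)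
open import Data.Sum using (_⊎_)
open import Function.Bundles using (_↔_; Inverse)
open import Function.Definitions using (Surjective)
open import Relation.Binary.PropositionalEquality using (_≡_)

-- A finite multigraph (loops and parallel edges allowed):
-- V vertices, E edges, edge e has (unordered) end-vertices ends e.
record Graph : Set where
  field
    V    : ℕ
    E    : ℕ
    ends : Fin E → Fin V × Fin V
open Graph public

data Reach (G : Graph) : Fin (V G) → Fin (V G) → Set where
  here  : ∀ {u} → Reach G u u
  stepˡ : ∀ {u w} (e : Fin (E G)) → proj₁ (ends G e) ≡ u →
          Reach G (proj₂ (ends G e)) w → Reach G u w
  stepʳ : ∀ {u w} (e : Fin (E G)) → proj₂ (ends G e) ≡ u →
          Reach G (proj₁ (ends G e)) w → Reach G u w

Connected : Graph → Set
Connected G = Fin (V G) × (∀ u v → Reach G u v)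

-- Darts (half-edges): (e , false) is the half of e at proj₁ (ends e),
-- (e , true) the half at proj₂ (ends e).
Dart : Graph → Set
Dart G = Fin (E G) × Bool

dartVertex : (G : Graph) → Dart G → Fin (V G)
dartVertex G (e , false) = proj₁ (ends G e)
dartVertex G (e , true)  = proj₂ (ends G e)

flip : (G : Graph) → Dart G → Dart G
flip G (e , b) = (e , not b)

iter : {A : Set} → (A → A) → ℕ → A → A
iter f zero    x = x
iter f (suc k) x = f (iter f k x)

-- A planar (combinatorial) embedding of G: a rotation system σ
-- (a permutation of darts cyclically permuting the darts at each vertex),
-- together with its faces (orbits of the face permutation φ = σ ∘ flip),
-- enumerated by Fin F, satisfying Euler's formula V - E + F = 2
-- (genus 0; for connected G this is exactly a plane embedding).
record PlanarEmbedding (G : Graph) : Set where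
  field
    σ          : Dart G ↔ Dart G
    σ-vertex   : ∀ d → dartVertex G (Inverse.to σ d) ≡ dartVertex G d
    σ-cyclic   : ∀ d d' → dartVertex G d ≡ dartVertex G d' →
                 ∃ λ k → iter (Inverse.to σ) k d ≡ d'
    F          : ℕ
    face       : Dart G → Fin F
    face-φ     : ∀ d → face (Inverse.to σ (flip G d)) ≡ face d
    face-orbit : ∀ d d' → face d ≡ face d' →
                 ∃ λ k → iter (λ x → Inverse.to σ (flip G x)) k d ≡ d'
    -- every face index is a face (vacuous for the edgeless graph,
    -- whose single face has no darts)
    face-onto  : E G ≡ 0 ⊎ Surjective _≡_ _≡_ face
    euler      : V G + F ≡ E G + 2
open PlanarEmbedding public

dual : (G : Graph) → PlanarEmbedding G → Graph
dual G 𝓖 = record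
  { V    = F 𝓖
  ; E    = E G
  ; ends = λ e → (face 𝓖 (e , false) , face 𝓖 (e , true))
  }

record Iso (G H : Graph) : Set where
  field
    vmap : Fin (V G) ↔ Fin (V H)
    emap : Fin (E G) ↔ Fin (E H)
    ends-pres : ∀ e →
      ( (Inverse.to vmap (proj₁ (ends G e)) ≡ proj₁ (ends H (Inverse.to emap e)))
      × (Inverse.to vmap (proj₂ (ends G e)) ≡ proj₂ (ends H (Inverse.to emap e))) )
      ⊎
      ( (Inverse.to vmap (proj₁ (ends G e)) ≡ proj₂ (ends H (Inverse.to emap e)))
      × (Inverse.to vmap (proj₂ (ends G e)) ≡ proj₁ (ends H (Inverse.to emap e))) )

_∼_ : Graph → Graph → Set
G₁ ∼ G₂ = Σ (PlanarEmbedding G₁) λ 𝓖₁ → Σ (PlanarEmbedding G₂) λ 𝓖₂ →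
            Iso (dual G₁ 𝓖₁) (dual G₂ 𝓖₂)

Planar : Graph → Set
Planar G = PlanarEmbedding G

-- G₁, G₂, G₃ are the theta graph with branches 0–2–3–1, 0–4–1, 0–5–1 plus two pendant edges:
-- a path of length two hanging at 2 (G₁), leaves at 2 and 3 (G₂), leaves at 4 and 5 (G₃).
-- In a plane embedding the theta graph has three faces; the two faces along the long branch
-- 0–2–3–1 are joined by three parallel dual edges, and a pendant edge becomes a loop at the face
-- containing it. So the dual of G₁ always has two loops at an end of a triple edge, and G₂ can
-- place its two loops either like that or at both ends of the triple edge, as G₃ can. But the only
-- face of G₃ containing both 4 and 5 lies between the two short branches, so no dual of G₃ has
-- two loops at an end of a triple edge.
-- Formally: at a vertex of degree at most three the rotation is fixed up to orientation, so σ is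
-- one of finitely many candidates, and the faces are read off from the orbits of σ ∘ flip for
-- each; the candidates with a single orbit are ruled out by Euler's formula.

{-# OPTIONS --safe #-}
module Submission where

open import Defs
open import Data.Bool as Bool using (Bool; true; false; if_then_else_)
open import Data.Fin as Fin using (Fin; zero; suc; toℕ)
open import Data.Fin.Patterns
open import Data.Fin.Properties using (all?; any?; injective⇒≤)
open import Data.List using (List; []; _∷_; map; iterate)
open import Data.List.Membership.Propositional using (_∈_; _∉_)
open import Data.List.Membership.Propositional.Properties using (∈-map⁻)
open import Data.List.Relation.Binary.Permutation.Propositional using (↭-refl; ↭-prep; ↭-swap)
open import Data.List.Relation.Binary.Permutation.Propositional.Properties using (∈-resp-↭)
open import Data.List.Relation.Unary.All as All using (All; []; _∷_)
open import Data.List.Relation.Unary.AllPairs using (allPairs?; []; _∷_)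
open import Data.List.Relation.Unary.Any as Any using (here; there)
open import Data.List.Relation.Unary.Unique.Propositional using (Unique)
open import Data.Nat as ℕ using (ℕ; zero; suc; _+_; _*_; _≤_; s≤s)
open import Data.Nat.Properties using (+-cancelˡ-≡; ≤-totalOrder)
open import Data.List.Extrema ≤-totalOrder using (argmin; argmin-all)
open import Data.Product as Product using (Σ; Σ-syntax; ∃; _×_; _,_; proj₁; proj₂)
open import Data.Product.Properties using (≡-dec)
open import Data.Sum using (_⊎_; inj₁; inj₂)
open import Data.Vec using (Vec; []; _∷_; lookup)
open import Function using (_∘_; _⇔_; Equivalence; mk⇔; Injection)
open import Function.Bundles using (Inverse; mk↔ₛ′)
open import Function.Definitions using (Injective; Surjective)
open import Function.Properties.Inverse using (↔-refl; ↔⇒↣)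
open import Relation.Binary using (DecidableEquality)
open import Relation.Binary.PropositionalEquality
open import Relation.Nullary using (¬_; Dec; does; contradiction)
open import Relation.Nullary.Decidable
  using (True; toWitness; from-yes; map′; ¬?; _×-dec_; _⊎-dec_; _→-dec_)

-- Unordered pairs and edge-injective maps

infix 4 _≈_ _∈ₑ_

_≈_ : {X : Set} → X × X → X × X → Set
p ≈ q = (proj₁ p ≡ proj₁ q × proj₂ p ≡ proj₂ q) ⊎ (proj₁ p ≡ proj₂ q × proj₂ p ≡ proj₁ q)

_∈ₑ_ : {X : Set} → X → X × X → Set
x ∈ₑ p = proj₁ p ≡ x ⊎ proj₂ p ≡ x

module _ {X : Set} where

  ≈-sym : {p q : X × X} → p ≈ q → q ≈ p
  ≈-sym (inj₁ (a , b)) = inj₁ (sym a , sym b)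
  ≈-sym (inj₂ (a , b)) = inj₂ (sym b , sym a)

  ≈-trans : {p q r : X × X} → p ≈ q → q ≈ r → p ≈ r
  ≈-trans (inj₁ (a , b)) (inj₁ (c , d)) = inj₁ (trans a c , trans b d)
  ≈-trans (inj₁ (a , b)) (inj₂ (c , d)) = inj₂ (trans a c , trans b d)
  ≈-trans (inj₂ (a , b)) (inj₁ (c , d)) = inj₂ (trans a d , trans b c)
  ≈-trans (inj₂ (a , b)) (inj₂ (c , d)) = inj₁ (trans a d , trans b c)

  ≈-map : {Y : Set} (f : X → Y) {p q : X × X} → p ≈ q → Product.map f f p ≈ Product.map f f q
  ≈-map f (inj₁ (a , b)) = inj₁ (cong f a , cong f b)
  ≈-map f (inj₂ (a , b)) = inj₂ (cong f a , cong f b)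

  ≈-diagonal : {p q : X × X} → p ≈ q → proj₁ p ≡ proj₂ p → proj₁ q ≡ proj₂ q
  ≈-diagonal (inj₁ (a , b)) p₁≡p₂ = trans (sym a) (trans p₁≡p₂ b)
  ≈-diagonal (inj₂ (a , b)) p₁≡p₂ = trans (sym b) (trans (sym p₁≡p₂) a)

  ∈ₑ-resp-≈ : {x : X} {p q : X × X} → p ≈ q → x ∈ₑ p → x ∈ₑ q
  ∈ₑ-resp-≈ (inj₁ (a , b)) (inj₁ c) = inj₁ (trans (sym a) c)
  ∈ₑ-resp-≈ (inj₁ (a , b)) (inj₂ c) = inj₂ (trans (sym b) c)
  ∈ₑ-resp-≈ (inj₂ (a , b)) (inj₁ c) = inj₂ (trans (sym a) c)
  ∈ₑ-resp-≈ (inj₂ (a , b)) (inj₂ c) = inj₁ (trans (sym b) c)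

  ≈? : DecidableEquality X → (p q : X × X) → Dec (p ≈ q)
  ≈? _≟_ p q = ((proj₁ p ≟ proj₁ q) ×-dec (proj₂ p ≟ proj₂ q)) ⊎-dec
               ((proj₁ p ≟ proj₂ q) ×-dec (proj₂ p ≟ proj₁ q))

  ∈ₑ? : DecidableEquality X → (x : X) (p : X × X) → Dec (x ∈ₑ p)
  ∈ₑ? _≟_ x p = (proj₁ p ≟ x) ⊎-dec (proj₂ p ≟ x)

  ∈ₑ-map : {Y : Set} (f : X → Y) {x : X} {p : X × X} → x ∈ₑ p → f x ∈ₑ Product.map f f p
  ∈ₑ-map f (inj₁ c) = inj₁ (cong f c)
  ∈ₑ-map f (inj₂ c) = inj₂ (cong f c)

record EdgeHom {X Y : Set} {m n : ℕ} (ends₁ : Fin m → X × X) (ends₂ : Fin n → Y × Y) : Set where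
  field
    vertex         : X → Y
    edge           : Fin m → Fin n
    edge-injective : Injective _≡_ _≡_ edge
    ends-preserved : ∀ e → Product.map vertex vertex (ends₁ e) ≈ ends₂ (edge e)

Iso⇒EdgeHom : {G H : Graph} → Iso G H → EdgeHom (ends G) (ends H)
Iso⇒EdgeHom i = record
  { vertex         = Inverse.to (Iso.vmap i)
  ; edge           = Inverse.to (Iso.emap i)
  ; edge-injective = Injection.injective (↔⇒↣ (Iso.emap i))
  ; ends-preserved = Iso.ends-pres i
  }

module _ {X : Set} {n : ℕ} (ends : Fin n → X × X) where

  IsLoop : Fin n → Set
  IsLoop e = proj₁ (ends e) ≡ proj₂ (ends e)

  Parallel : Fin n → Fin n → Set
  Parallel e f = ends e ≈ ends f

  TwoLoopsAtTripleEdge : Set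
  TwoLoopsAtTripleEdge =
    Σ[ ℓ₁ ∈ Fin n ] IsLoop ℓ₁ ×
    Σ[ ℓ₂ ∈ Fin n ] (ℓ₂ ∉ ℓ₁ ∷ [] × IsLoop ℓ₂ × Parallel ℓ₂ ℓ₁) ×
    Σ[ g₁ ∈ Fin n ] (g₁ ∉ ℓ₁ ∷ ℓ₂ ∷ [] × proj₁ (ends ℓ₁) ∈ₑ ends g₁) ×
    Σ[ g₂ ∈ Fin n ] (g₂ ∉ ℓ₁ ∷ ℓ₂ ∷ g₁ ∷ [] × Parallel g₂ g₁) ×
    Σ[ g₃ ∈ Fin n ] (g₃ ∉ ℓ₁ ∷ ℓ₂ ∷ g₁ ∷ g₂ ∷ [] × Parallel g₃ g₁)

  twoLoopsAtTripleEdge? : DecidableEquality X → Dec TwoLoopsAtTripleEdge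
  twoLoopsAtTripleEdge? _≟_ =
    any? λ ℓ₁ → loop? ℓ₁ ×-dec
    any? λ ℓ₂ → (ℓ₂ ∉? ℓ₁ ∷ [] ×-dec loop? ℓ₂ ×-dec parallel? ℓ₂ ℓ₁) ×-dec
    any? λ g₁ → (g₁ ∉? ℓ₁ ∷ ℓ₂ ∷ [] ×-dec ∈ₑ? _≟_ (proj₁ (ends ℓ₁)) (ends g₁)) ×-dec
    any? λ g₂ → (g₂ ∉? ℓ₁ ∷ ℓ₂ ∷ g₁ ∷ [] ×-dec parallel? g₂ g₁) ×-dec
    any? λ g₃ → g₃ ∉? ℓ₁ ∷ ℓ₂ ∷ g₁ ∷ g₂ ∷ [] ×-dec parallel? g₃ g₁
    where
    infix 4 _∉?_
    _∉?_ : (e : Fin n) (es : List (Fin n)) → Dec (e ∉ es)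
    e ∉? es = ¬? (Any.any? (e Fin.≟_) es)
    loop? : ∀ e → Dec (IsLoop e)
    loop? e = proj₁ (ends e) ≟ proj₂ (ends e)
    parallel? : ∀ e f → Dec (Parallel e f)
    parallel? e f = ≈? _≟_ (ends e) (ends f)

module _ {X Y : Set} {m n : ℕ} {ends₁ : Fin m → X × X} {ends₂ : Fin n → Y × Y}
         (h : EdgeHom ends₁ ends₂) where
  open EdgeHom h

  private
    loop-preserved : ∀ {e} → IsLoop ends₁ e → IsLoop ends₂ (edge e)
    loop-preserved {e} loop = ≈-diagonal (ends-preserved e) (cong vertex loop)

    parallel-preserved : ∀ {e f} → Parallel ends₁ e f → Parallel ends₂ (edge e) (edge f)
    parallel-preserved {e} {f} e∥f =
      ≈-trans (≈-sym (ends-preserved e)) (≈-trans (≈-map vertex e∥f) (ends-preserved f))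

    ∉-preserved : ∀ {e es} → e ∉ es → edge e ∉ map edge es
    ∉-preserved {es = es} e∉es e∈ with ∈-map⁻ edge e∈
    ... | _ , e′∈es , eq = e∉es (subst (_∈ es) (sym (edge-injective eq)) e′∈es)

    loop-vertex : ∀ {ℓ} → IsLoop ends₁ ℓ → proj₁ (ends₂ (edge ℓ)) ≡ vertex (proj₁ (ends₁ ℓ))
    loop-vertex {ℓ} loop with ends-preserved ℓ
    ... | inj₁ (a , _) = sym a
    ... | inj₂ (_ , b) = trans (sym b) (cong vertex (sym loop))

  transport : TwoLoopsAtTripleEdge ends₁ → TwoLoopsAtTripleEdge ends₂
  transport (ℓ₁ , loop₁ , ℓ₂ , (ℓ₂∉ , loop₂ , ℓ₂∥ℓ₁) , g₁ , (g₁∉ , ℓ₁∈g₁) ,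
             g₂ , (g₂∉ , g₂∥g₁) , g₃ , (g₃∉ , g₃∥g₁)) =
    edge ℓ₁ , loop-preserved loop₁ ,
    edge ℓ₂ , (∉-preserved ℓ₂∉ , loop-preserved loop₂ , parallel-preserved ℓ₂∥ℓ₁) ,
    edge g₁ , (∉-preserved g₁∉ , incident) ,
    edge g₂ , (∉-preserved g₂∉ , parallel-preserved g₂∥g₁) ,
    edge g₃ , (∉-preserved g₃∉ , parallel-preserved g₃∥g₁)
    where
    incident : proj₁ (ends₂ (edge ℓ₁)) ∈ₑ ends₂ (edge g₁)
    incident = subst (_∈ₑ ends₂ (edge g₁)) (sym (loop-vertex loop₁))
                     (∈ₑ-resp-≈ (ends-preserved g₁) (∈ₑ-map vertex ℓ₁∈g₁))

module _ {G : Graph} where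

  Reach-trans : ∀ {u v w} → Reach G u v → Reach G v w → Reach G u w
  Reach-trans here            q = q
  Reach-trans (stepˡ e eq p) q = stepˡ e eq (Reach-trans p q)
  Reach-trans (stepʳ e eq p) q = stepʳ e eq (Reach-trans p q)

  Reach-sym : ∀ {u v} → Reach G u v → Reach G v u
  Reach-sym here              = here
  Reach-sym (stepˡ e refl p) = Reach-trans (Reach-sym p) (stepʳ e refl here)
  Reach-sym (stepʳ e refl p) = Reach-trans (Reach-sym p) (stepˡ e refl here)

  connected-via : (c : Fin (V G)) → (∀ u → Reach G u c) → Connected G
  connected-via c to-c = c , λ u v → Reach-trans (to-c u) (Reach-sym (to-c v))

-- Rotations at vertices of degree at most three

infix 4 _≟ᵈ_

_≟ᵈ_ : ∀ {n} → DecidableEquality (Fin n × Bool)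
_≟ᵈ_ = ≡-dec Fin._≟_ Bool._≟_

∀-Bool? : {P : Bool → Set} → (∀ b → Dec (P b)) → Dec (∀ b → P b)
∀-Bool? P? = map′ (λ { (f , t) false → f ; (f , t) true → t }) (λ h → h false , h true)
                  (P? false ×-dec P? true)

allDarts? : ∀ {n} {P : Fin n × Bool → Set} → (∀ d → Dec (P d)) → Dec (∀ d → P d)
allDarts? P? = map′ (λ h (e , b) → h e b) (λ h e b → h (e , b)) (all? λ e → ∀-Bool? λ b → P? (e , b))

ListsDartsAt : (G : Graph) → Fin (V G) → List (Dart G) → Set
ListsDartsAt G v ds = Unique ds × (∀ d → dartVertex G d ≡ v ⇔ d ∈ ds)

listsDartsAt? : (G : Graph) (v : Fin (V G)) (ds : List (Dart G)) → Dec (ListsDartsAt G v ds)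
listsDartsAt? G v ds =
  allPairs? (λ d d′ → ¬? (d ≟ᵈ d′)) ds ×-dec
  allDarts? λ d → map′ (λ (to , from) → mk⇔ to from) (λ i → Equivalence.to i , Equivalence.from i)
                       ((dartVertex G d Fin.≟ v →-dec Any.any? (d ≟ᵈ_) ds) ×-dec
                        (Any.any? (d ≟ᵈ_) ds →-dec dartVertex G d Fin.≟ v))

Rotates : {D : Set} → (D → D) → D → D → D → Bool → Set
Rotates f a b c t = f a ≡ (if t then b else c) × f b ≡ (if t then c else a) × f c ≡ (if t then a else b)

module _ {D : Set} {s : D → D} where

  iter-fixed : ∀ {a} → s a ≡ a → ∀ k → iter s k a ≡ a
  iter-fixed sa≡a zero    = refl
  iter-fixed sa≡a (suc k) = trans (cong s (iter-fixed sa≡a k)) sa≡a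

  iter-swap : ∀ {a b} → s a ≡ b → s b ≡ a → ∀ k → iter s k a ∈ a ∷ b ∷ []
  iter-swap sa≡b sb≡a zero = here refl
  iter-swap sa≡b sb≡a (suc k) with iter-swap sa≡b sb≡a k
  ... | here sᵏa≡a         = there (here (trans (cong s sᵏa≡a) sa≡b))
  ... | there (here sᵏa≡b) = here (trans (cong s sᵏa≡b) sb≡a)

  module _ (s-injective : Injective _≡_ _≡_ s) where

    three-cycle : ∀ {a b c} → a ≢ b → a ≢ c → b ≢ c →
                  s b ∈ a ∷ b ∷ c ∷ [] → s c ∈ a ∷ b ∷ c ∷ [] → ∃ (λ k → iter s k a ≡ c) →
                  s a ≡ b → s b ≡ c × s c ≡ a
    three-cycle _ a≢c b≢c (here sb≡a) _ (k , sᵏa≡c) sa≡b with iter-swap sa≡b sb≡a k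
    ... | here sᵏa≡a         = contradiction (trans (sym sᵏa≡a) sᵏa≡c) a≢c
    ... | there (here sᵏa≡b) = contradiction (trans (sym sᵏa≡b) sᵏa≡c) b≢c
    three-cycle a≢b _ _ (there (here sb≡b)) _ _ sa≡b =
      contradiction (s-injective (trans sa≡b (sym sb≡b))) a≢b
    three-cycle _ _ _ (there (there (here sb≡c))) (here sc≡a) _ _ = sb≡c , sc≡a
    three-cycle _ a≢c _ (there (there (here _))) (there (here sc≡b)) _ sa≡b =
      contradiction (s-injective (trans sa≡b (sym sc≡b))) a≢c
    three-cycle _ _ b≢c (there (there (here sb≡c))) (there (there (here sc≡c))) _ _ =
      contradiction (s-injective (trans sb≡c (sym sc≡c))) b≢c

rotation : {G : Graph} → PlanarEmbedding G → Dart G → Dart G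
rotation P = Inverse.to (σ P)

module LocalRotation {G : Graph} (P : PlanarEmbedding G) where

  private
    s = rotation P

    s-injective : Injective _≡_ _≡_ s
    s-injective = Injection.injective (↔⇒↣ (σ P))

    closed : ∀ {v ds d} → ListsDartsAt G v ds → d ∈ ds → s d ∈ ds
    closed {d = d} (_ , at) d∈ =
      Equivalence.to (at (s d)) (trans (σ-vertex P d) (Equivalence.from (at d) d∈))

    reachable : ∀ {v ds d d′} → ListsDartsAt G v ds → d ∈ ds → d′ ∈ ds → ∃ λ k → iter s k d ≡ d′
    reachable {d = d} {d′} (_ , at) d∈ d′∈ =
      σ-cyclic P d d′ (trans (Equivalence.from (at d) d∈) (sym (Equivalence.from (at d′) d′∈)))

    unreachable-from-fixed : ∀ {v a b ds} → ListsDartsAt G v (a ∷ b ∷ ds) → s a ≡ a → a ≡ b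
    unreachable-from-fixed l sa≡a with reachable l (here refl) (there (here refl))
    ... | k , sᵏa≡b = trans (sym (iter-fixed sa≡a k)) sᵏa≡b

  AgreesAt : Fin (V G) → (Dart G → Dart G) → Set
  AgreesAt v r = ∀ d → dartVertex G d ≡ v → rotation P d ≡ r d

  agrees-on-list : ∀ {v ds r} → ListsDartsAt G v ds → All (λ d → rotation P d ≡ r d) ds → AgreesAt v r
  agrees-on-list (_ , at) s≗r d dv = All.lookup s≗r (Equivalence.to (at d) dv)

  agrees-everywhere : ∀ {r} → (∀ v → AgreesAt v r) → ∀ d → rotation P d ≡ r d
  agrees-everywhere agrees d = agrees (dartVertex G d) d refl

  agrees-at-leaf : ∀ {v a r} → ListsDartsAt G v (a ∷ []) → r a ≡ a → AgreesAt v r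
  agrees-at-leaf l ra≡a with closed l (here refl)
  ... | here sa≡a = agrees-on-list l (trans sa≡a (sym ra≡a) ∷ [])

  agrees-at-degree-2 : ∀ {v a b r} → ListsDartsAt G v (a ∷ b ∷ []) → r a ≡ b → r b ≡ a → AgreesAt v r
  agrees-at-degree-2 l@(((a≢b ∷ []) ∷ [] ∷ []) , _) ra≡b rb≡a
    with closed l (here refl) | closed l (there (here refl))
  ... | here sa≡a         | _                  = contradiction (unreachable-from-fixed l sa≡a) a≢b
  ... | there (here sa≡b) | there (here sb≡b) = contradiction (s-injective (trans sa≡b (sym sb≡b))) a≢b
  ... | there (here sa≡b) | here sb≡a         =
    agrees-on-list l (trans sa≡b (sym ra≡b) ∷ trans sb≡a (sym rb≡a) ∷ [])

  rotates-at-degree-3 : ∀ {v a b c} → ListsDartsAt G v (a ∷ b ∷ c ∷ []) → Σ Bool (Rotates (rotation P) a b c)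
  rotates-at-degree-3 {a = a} {b} {c} l@(((a≢b ∷ a≢c ∷ []) ∷ (b≢c ∷ []) ∷ [] ∷ []) , _)
    with closed l (here refl) | closed l (there (here refl)) | closed l (there (there (here refl)))
  ... | here sa≡a | _ | _ = contradiction (unreachable-from-fixed l sa≡a) a≢b
  ... | there (here sa≡b) | sb∈ | sc∈ =
    let sb≡c , sc≡a = three-cycle s-injective a≢b a≢c b≢c sb∈ sc∈
                        (reachable l (here refl) (there (there (here refl)))) sa≡b
    in true , sa≡b , sb≡c , sc≡a
  ... | there (there (here sa≡c)) | sb∈ | sc∈ =
    let sc≡b , sb≡a = three-cycle s-injective a≢c a≢b (b≢c ∘ sym) (swap sc∈) (swap sb∈)
                        (reachable l (here refl) (there (here refl))) sa≡c
    in false , sa≡c , sb≡a , sc≡b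
    where
    swap : ∀ {x} → x ∈ a ∷ b ∷ c ∷ [] → x ∈ a ∷ c ∷ b ∷ []
    swap = ∈-resp-↭ (↭-prep a (↭-swap b c ↭-refl))

  agrees-at-degree-3 : ∀ {v a b c} → ListsDartsAt G v (a ∷ b ∷ c ∷ []) →
                       Σ Bool λ t → ∀ {r} → Rotates r a b c t → AgreesAt v r
  agrees-at-degree-3 l with rotates-at-degree-3 l
  ... | t , sa , sb , sc = t , λ (ra , rb , rc) →
    agrees-on-list l (trans sa (sym ra) ∷ trans sb (sym rb) ∷ trans sc (sym rc) ∷ [])

-- Faces as orbits

faceStep : (G : Graph) → (Dart G → Dart G) → Dart G → Dart G
faceStep G r d = r (flip G d)

All-iterate : {A : Set} {P : A → Set} {f : A → A} → (∀ {x} → P x → P (f x)) →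
              ∀ {x} n → P x → All P (iterate f x n)
All-iterate step zero    px = []
All-iterate step (suc n) px = px ∷ All-iterate step n (step px)

dartKey : (G : Graph) → Dart G → ℕ
dartKey G (e , b) = 2 * toℕ e + (if b then 1 else 0)

-- Orbits have at most 2E darts, so orbitRoot G r d is the least dart of the orbit of d.
-- It is opaque because its normal form at an unknown rotation r is exponentially large.
opaque
  orbitRoot : (G : Graph) → (Dart G → Dart G) → Dart G → Dart G
  orbitRoot G r d = argmin (dartKey G) d (iterate (faceStep G r) d (2 * E G))

  orbitRoot-closure : ∀ {G r} {P : Dart G → Set} → (∀ {x} → P x → P (faceStep G r x)) →
                      ∀ {d} → P d → P (orbitRoot G r d)
  orbitRoot-closure {G} {P = P} step {d} Pd =
    argmin-all (dartKey G) {P = P} Pd (All-iterate step (2 * E G) Pd)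

OrbitRootInvariant : (G : Graph) → (Dart G → Dart G) → Set
OrbitRootInvariant G r = ∀ d → orbitRoot G r (faceStep G r d) ≡ orbitRoot G r d

orbitDual : (G : Graph) → (Dart G → Dart G) → Fin (E G) → Dart G × Dart G
orbitDual G r e = orbitRoot G r (e , false) , orbitRoot G r (e , true)

iter-cong : {A : Set} {f g : A → A} → (∀ x → f x ≡ g x) → ∀ k x → iter f k x ≡ iter g k x
iter-cong f≗g zero    x = refl
iter-cong {f = f} f≗g (suc k) x = trans (cong f (iter-cong f≗g k x)) (f≗g _)

face-surjective : {G : Graph} (P : PlanarEmbedding G) → E G ≢ 0 → Surjective _≡_ _≡_ (face P)
face-surjective P E≢0 with face-onto P
... | inj₁ E≡0       = contradiction E≡0 E≢0
... | inj₂ surjective = surjective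

module OrbitFaces {G : Graph} (P : PlanarEmbedding G) {r : Dart G → Dart G}
                  (σ≗r : ∀ d → rotation P d ≡ r d) where
  open ≡-Reasoning

  face-step : ∀ d → face P (faceStep G r d) ≡ face P d
  face-step d = trans (cong (face P) (sym (σ≗r (flip G d)))) (face-φ P d)

  face-orbitRoot : ∀ d → face P (orbitRoot G r d) ≡ face P d
  face-orbitRoot d = orbitRoot-closure {P = λ x → face P x ≡ face P d} (trans (face-step _)) refl

  orbitDual⇒dual : EdgeHom (orbitDual G r) (ends (dual G P))
  orbitDual⇒dual = record
    { vertex         = face P
    ; edge           = λ e → e
    ; edge-injective = λ eq → eq
    ; ends-preserved = λ e → inj₁ (face-orbitRoot (e , false) , face-orbitRoot (e , true))
    }

  single-orbit⇒F≤1 : Surjective _≡_ _≡_ (face P) → ∀ {d₀} → (∀ d → orbitRoot G r d ≡ d₀) → F P ≤ 1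
  single-orbit⇒F≤1 surjective {d₀} single =
    injective⇒≤ {f = λ _ → zero {0}} λ _ → trans (on-d₀ _) (sym (on-d₀ _))
    where
    on-d₀ : ∀ i → i ≡ face P d₀
    on-d₀ i = let d , face≡i = surjective i in begin
      i                        ≡⟨ sym (face≡i refl) ⟩
      face P d                 ≡⟨ sym (face-orbitRoot d) ⟩
      face P (orbitRoot G r d) ≡⟨ cong (face P) (single d) ⟩
      face P d₀                ∎

  module _ (invariant : OrbitRootInvariant G r) where

    orbitRoot-iter : ∀ k d → orbitRoot G r (iter (faceStep G r) k d) ≡ orbitRoot G r d
    orbitRoot-iter zero    d = refl
    orbitRoot-iter (suc k) d = trans (invariant _) (orbitRoot-iter k d)

    sameFace⇒sameRoot : ∀ {d d′} → face P d ≡ face P d′ → orbitRoot G r d ≡ orbitRoot G r d′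
    sameFace⇒sameRoot {d} {d′} eq with face-orbit P d d′ eq
    ... | k , d↦d′ = begin
      orbitRoot G r d                                    ≡⟨ sym (orbitRoot-iter k d) ⟩
      orbitRoot G r (iter (faceStep G r) k d)            ≡⟨ cong (orbitRoot G r) r↔σ ⟩
      orbitRoot G r (iter (faceStep G (rotation P)) k d) ≡⟨ cong (orbitRoot G r) d↦d′ ⟩
      orbitRoot G r d′                                   ∎
      where r↔σ = iter-cong (λ x → sym (σ≗r (flip G x))) k d

    dual⇒orbitDual : Surjective _≡_ _≡_ (face P) → EdgeHom (ends (dual G P)) (orbitDual G r)
    dual⇒orbitDual surjective = record
      { vertex         = λ i → orbitRoot G r (proj₁ (surjective i))
      ; edge           = λ e → e
      ; edge-injective = λ eq → eq
      ; ends-preserved = λ e → inj₁ (root-of-face (e , false) , root-of-face (e , true))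
      }
      where
      root-of-face : ∀ d → orbitRoot G r (proj₁ (surjective (face P d))) ≡ orbitRoot G r d
      root-of-face d = sameFace⇒sameRoot (proj₂ (surjective (face P d)) refl)

-- Embeddings given by explicit rotations

Reaches : {A : Set} → (A → A) → ℕ → A → A → Set
Reaches f n x y = Σ (Fin n) λ k → iter f (toℕ k) x ≡ y

positionIn : ∀ {n k} → Fin n × Bool → Vec (Fin n × Bool) (suc k) → Fin (suc k)
positionIn d (x ∷ [])     = zero
positionIn d (x ∷ y ∷ ys) = if does (d ≟ᵈ x) then zero else suc (positionIn d (y ∷ ys))

module FromRotation (G : Graph) (r r⁻¹ : Dart G → Dart G) {k : ℕ} (roots : Vec (Dart G) (suc k)) where

  faceLabel : Dart G → Fin (suc k)
  faceLabel d = positionIn (orbitRoot G r d) roots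

  Axioms : Set
  Axioms =
    (∀ d → r (r⁻¹ d) ≡ d) × (∀ d → r⁻¹ (r d) ≡ d) ×
    (∀ d → dartVertex G (r d) ≡ dartVertex G d) ×
    (∀ d d′ → dartVertex G d ≡ dartVertex G d′ → Reaches r (2 * E G) d d′) ×
    (∀ d → faceLabel (faceStep G r d) ≡ faceLabel d) ×
    (∀ d d′ → faceLabel d ≡ faceLabel d′ → Reaches (faceStep G r) (2 * E G) d d′) ×
    (∀ i → faceLabel (lookup roots i) ≡ i) ×
    V G + suc k ≡ E G + 2

  axioms? : Dec Axioms
  axioms? =
    allDarts? (λ d → r (r⁻¹ d) ≟ᵈ d) ×-dec
    allDarts? (λ d → r⁻¹ (r d) ≟ᵈ d) ×-dec
    allDarts? (λ d → dartVertex G (r d) Fin.≟ dartVertex G d) ×-dec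
    allDarts? (λ d → allDarts? λ d′ → dartVertex G d Fin.≟ dartVertex G d′ →-dec reaches? r d d′) ×-dec
    allDarts? (λ d → faceLabel (faceStep G r d) Fin.≟ faceLabel d) ×-dec
    allDarts? (λ d → allDarts? λ d′ → faceLabel d Fin.≟ faceLabel d′ →-dec reaches? (faceStep G r) d d′) ×-dec
    all? (λ i → faceLabel (lookup roots i) Fin.≟ i) ×-dec
    V G + suc k ℕ.≟ E G + 2
    where
    reaches? : (f : Dart G → Dart G) → ∀ d d′ → Dec (Reaches f (2 * E G) d d′)
    reaches? f d d′ = any? λ k → iter f (toℕ k) d ≟ᵈ d′

  fromAxioms : Axioms → PlanarEmbedding G
  fromAxioms (r∘r⁻¹ , r⁻¹∘r , r-vertex , r-cyclic , label-step , label-orbit , label-roots , euler′) = record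
    { σ          = mk↔ₛ′ r r⁻¹ r∘r⁻¹ r⁻¹∘r
    ; σ-vertex   = r-vertex
    ; σ-cyclic   = λ d d′ eq → iterations (r-cyclic d d′ eq)
    ; F          = suc k
    ; face       = faceLabel
    ; face-φ     = label-step
    ; face-orbit = λ d d′ eq → iterations (label-orbit d d′ eq)
    ; face-onto  = inj₂ λ i → lookup roots i , λ { refl → label-roots i }
    ; euler      = euler′
    }
    where
    iterations : ∀ {f : Dart G → Dart G} {d d′} → Reaches f (2 * E G) d d′ → ∃ λ n → iter f n d ≡ d′
    iterations (n , eq) = toℕ n , eq

  embedding : {True axioms?} → PlanarEmbedding G
  embedding {axioms} = fromAxioms (toWitness axioms)

-- The three graphs and their embeddings

thetaPlus : Fin 8 × Fin 8 → Fin 8 × Fin 8 → Graph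
thetaPlus e₇ e₈ = record { V = 8 ; E = 9 ; ends = ends′ }
  where
  ends′ : Fin 9 → Fin 8 × Fin 8
  ends′ 0F = 0F , 2F
  ends′ 1F = 2F , 3F
  ends′ 2F = 3F , 1F
  ends′ 3F = 0F , 4F
  ends′ 4F = 4F , 1F
  ends′ 5F = 0F , 5F
  ends′ 6F = 5F , 1F
  ends′ 7F = e₇
  ends′ 8F = e₈

G₁ G₂ G₃ : Graph
G₁ = thetaPlus (2F , 6F) (6F , 7F)
G₂ = thetaPlus (2F , 6F) (3F , 7F)
G₃ = thetaPlus (4F , 6F) (5F , 7F)

reach-0₁ : ∀ u → Reach G₁ u 0F
reach-0₁ 0F = here
reach-0₁ 1F = stepʳ 2F refl (stepʳ 1F refl (stepʳ 0F refl here))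
reach-0₁ 2F = stepʳ 0F refl here
reach-0₁ 3F = stepʳ 1F refl (stepʳ 0F refl here)
reach-0₁ 4F = stepʳ 3F refl here
reach-0₁ 5F = stepʳ 5F refl here
reach-0₁ 6F = stepʳ 7F refl (stepʳ 0F refl here)
reach-0₁ 7F = stepʳ 8F refl (stepʳ 7F refl (stepʳ 0F refl here))

reach-0₂ : ∀ u → Reach G₂ u 0F
reach-0₂ 0F = here
reach-0₂ 1F = stepʳ 2F refl (stepʳ 1F refl (stepʳ 0F refl here))
reach-0₂ 2F = stepʳ 0F refl here
reach-0₂ 3F = stepʳ 1F refl (stepʳ 0F refl here)
reach-0₂ 4F = stepʳ 3F refl here
reach-0₂ 5F = stepʳ 5F refl here
reach-0₂ 6F = stepʳ 7F refl (stepʳ 0F refl here)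
reach-0₂ 7F = stepʳ 8F refl (stepʳ 1F refl (stepʳ 0F refl here))

reach-0₃ : ∀ u → Reach G₃ u 0F
reach-0₃ 0F = here
reach-0₃ 1F = stepʳ 2F refl (stepʳ 1F refl (stepʳ 0F refl here))
reach-0₃ 2F = stepʳ 0F refl here
reach-0₃ 3F = stepʳ 1F refl (stepʳ 0F refl here)
reach-0₃ 4F = stepʳ 3F refl here
reach-0₃ 5F = stepʳ 5F refl here
reach-0₃ 6F = stepʳ 7F refl (stepʳ 3F refl here)
reach-0₃ 7F = stepʳ 8F refl (stepʳ 5F refl here)

-- tᵥ is the orientation at the vertex v of degree three; reversing all of them inverts the rotation.

thetaRotation : Bool → Bool → Fin 9 × Bool → Fin 9 × Bool
thetaRotation t₀ t₁ (0F , false) = if t₀ then (3F , false) else (5F , false)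
thetaRotation t₀ t₁ (3F , false) = if t₀ then (5F , false) else (0F , false)
thetaRotation t₀ t₁ (5F , false) = if t₀ then (0F , false) else (3F , false)
thetaRotation t₀ t₁ (2F , true)  = if t₁ then (4F , true)  else (6F , true)
thetaRotation t₀ t₁ (4F , true)  = if t₁ then (6F , true)  else (2F , true)
thetaRotation t₀ t₁ (6F , true)  = if t₁ then (2F , true)  else (4F , true)
thetaRotation t₀ t₁ (0F , true)  = 1F , false
thetaRotation t₀ t₁ (1F , false) = 0F , true
thetaRotation t₀ t₁ (1F , true)  = 2F , false
thetaRotation t₀ t₁ (2F , false) = 1F , true
thetaRotation t₀ t₁ (3F , true)  = 4F , false
thetaRotation t₀ t₁ (4F , false) = 3F , true
thetaRotation t₀ t₁ (5F , true)  = 6F , false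
thetaRotation t₀ t₁ (6F , false) = 5F , true
thetaRotation t₀ t₁ d            = d

rotation₁ : Bool → Bool → Bool → Dart G₁ → Dart G₁
rotation₁ t₀ t₁ t₂ (0F , true)  = if t₂ then (1F , false) else (7F , false)
rotation₁ t₀ t₁ t₂ (1F , false) = if t₂ then (7F , false) else (0F , true)
rotation₁ t₀ t₁ t₂ (7F , false) = if t₂ then (0F , true)  else (1F , false)
rotation₁ t₀ t₁ t₂ (7F , true)  = 8F , false
rotation₁ t₀ t₁ t₂ (8F , false) = 7F , true
rotation₁ t₀ t₁ t₂ d            = thetaRotation t₀ t₁ d

rotation₂ : Bool → Bool → Bool → Bool → Dart G₂ → Dart G₂
rotation₂ t₀ t₁ t₂ t₃ (0F , true)  = if t₂ then (1F , false) else (7F , false)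
rotation₂ t₀ t₁ t₂ t₃ (1F , false) = if t₂ then (7F , false) else (0F , true)
rotation₂ t₀ t₁ t₂ t₃ (7F , false) = if t₂ then (0F , true)  else (1F , false)
rotation₂ t₀ t₁ t₂ t₃ (1F , true)  = if t₃ then (2F , false) else (8F , false)
rotation₂ t₀ t₁ t₂ t₃ (2F , false) = if t₃ then (8F , false) else (1F , true)
rotation₂ t₀ t₁ t₂ t₃ (8F , false) = if t₃ then (1F , true)  else (2F , false)
rotation₂ t₀ t₁ t₂ t₃ d            = thetaRotation t₀ t₁ d

rotation₃ : Bool → Bool → Bool → Bool → Dart G₃ → Dart G₃
rotation₃ t₀ t₁ t₄ t₅ (3F , true)  = if t₄ then (4F , false) else (7F , false)
rotation₃ t₀ t₁ t₄ t₅ (4F , false) = if t₄ then (7F , false) else (3F , true)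
rotation₃ t₀ t₁ t₄ t₅ (7F , false) = if t₄ then (3F , true)  else (4F , false)
rotation₃ t₀ t₁ t₄ t₅ (5F , true)  = if t₅ then (6F , false) else (8F , false)
rotation₃ t₀ t₁ t₄ t₅ (6F , false) = if t₅ then (8F , false) else (5F , true)
rotation₃ t₀ t₁ t₄ t₅ (8F , false) = if t₅ then (5F , true)  else (6F , false)
rotation₃ t₀ t₁ t₄ t₅ d            = thetaRotation t₀ t₁ d

faceRoots : Vec (Fin 9 × Bool) 3
faceRoots = (0F , false) ∷ (0F , true) ∷ (3F , true) ∷ []

Iso-of-same-ends : ∀ {n m} {ends₁ ends₂ : Fin m → Fin n × Fin n} → (∀ e → ends₁ e ≡ ends₂ e) →
                   Iso (record { V = n ; E = m ; ends = ends₁ }) (record { V = n ; E = m ; ends = ends₂ })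
Iso-of-same-ends same = record
  { vmap      = ↔-refl
  ; emap      = ↔-refl
  ; ends-pres = λ e → inj₁ (cong proj₁ (same e) , cong proj₂ (same e))
  }

sameEnds? : ∀ {n m} (ends₁ ends₂ : Fin m → Fin n × Fin n) → Dec (∀ e → ends₁ e ≡ ends₂ e)
sameEnds? ends₁ ends₂ = all? λ e → ≡-dec Fin._≟_ Fin._≟_ (ends₁ e) (ends₂ e)

opaque
  unfolding orbitRoot

  embedding₁ : PlanarEmbedding G₁
  embedding₁ =
    FromRotation.embedding G₁ (rotation₁ true false true) (rotation₁ false true false) faceRoots

  embedding₂ embedding₂′ : PlanarEmbedding G₂
  embedding₂ =
    FromRotation.embedding G₂ (rotation₂ true false true true) (rotation₂ false true false false) faceRoots
  embedding₂′ =
    FromRotation.embedding G₂ (rotation₂ true false true false) (rotation₂ false true false true) faceRoots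

  embedding₃ : PlanarEmbedding G₃
  embedding₃ =
    FromRotation.embedding G₃ (rotation₃ true false false true) (rotation₃ false true true false) faceRoots

  G₁∼G₂ : G₁ ∼ G₂
  G₁∼G₂ = embedding₁ , embedding₂ ,
    Iso-of-same-ends (from-yes (sameEnds? (ends (dual G₁ embedding₁)) (ends (dual G₂ embedding₂))))

  G₂∼G₃ : G₂ ∼ G₃
  G₂∼G₃ = embedding₂′ , embedding₃ ,
    Iso-of-same-ends (from-yes (sameEnds? (ends (dual G₂ embedding₂′)) (ends (dual G₃ embedding₃))))

-- Classifying the embeddings of G₁ and G₃

-- Opaque, so that the orientations extracted below stay small stuck terms instead of
-- unfolding the evaluated proof.
opaque
  listsDartsAt : (G : Graph) (v : Fin (V G)) (ds : List (Dart G)) →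
                 {True (listsDartsAt? G v ds)} → ListsDartsAt G v ds
  listsDartsAt G v ds {listed} = toWitness listed

module _ (P : PlanarEmbedding G₁) where
  open LocalRotation P

  rotation₁-complete : Σ Bool λ t₀ → Σ Bool λ t₁ → Σ Bool λ t₂ → ∀ d → rotation P d ≡ rotation₁ t₀ t₁ t₂ d
  rotation₁-complete =
    let t₀ , at₀ = agrees-at-degree-3 (listsDartsAt G₁ 0F ((0F , false) ∷ (3F , false) ∷ (5F , false) ∷ []))
        t₁ , at₁ = agrees-at-degree-3 (listsDartsAt G₁ 1F ((2F , true) ∷ (4F , true) ∷ (6F , true) ∷ []))
        t₂ , at₂ = agrees-at-degree-3 (listsDartsAt G₁ 2F ((0F , true) ∷ (1F , false) ∷ (7F , false) ∷ []))
    in t₀ , t₁ , t₂ , agrees-everywhere λ where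
      0F → at₀ (refl , refl , refl)
      1F → at₁ (refl , refl , refl)
      2F → at₂ (refl , refl , refl)
      3F → agrees-at-degree-2 (listsDartsAt G₁ 3F ((1F , true) ∷ (2F , false) ∷ [])) refl refl
      4F → agrees-at-degree-2 (listsDartsAt G₁ 4F ((3F , true) ∷ (4F , false) ∷ [])) refl refl
      5F → agrees-at-degree-2 (listsDartsAt G₁ 5F ((5F , true) ∷ (6F , false) ∷ [])) refl refl
      6F → agrees-at-degree-2 (listsDartsAt G₁ 6F ((7F , true) ∷ (8F , false) ∷ [])) refl refl
      7F → agrees-at-leaf (listsDartsAt G₁ 7F ((8F , true) ∷ [])) refl

module _ (P : PlanarEmbedding G₃) where
  open LocalRotation P

  rotation₃-complete : Σ Bool λ t₀ → Σ Bool λ t₁ → Σ Bool λ t₄ → Σ Bool λ t₅ →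
                       ∀ d → rotation P d ≡ rotation₃ t₀ t₁ t₄ t₅ d
  rotation₃-complete =
    let t₀ , at₀ = agrees-at-degree-3 (listsDartsAt G₃ 0F ((0F , false) ∷ (3F , false) ∷ (5F , false) ∷ []))
        t₁ , at₁ = agrees-at-degree-3 (listsDartsAt G₃ 1F ((2F , true) ∷ (4F , true) ∷ (6F , true) ∷ []))
        t₄ , at₄ = agrees-at-degree-3 (listsDartsAt G₃ 4F ((3F , true) ∷ (4F , false) ∷ (7F , false) ∷ []))
        t₅ , at₅ = agrees-at-degree-3 (listsDartsAt G₃ 5F ((5F , true) ∷ (6F , false) ∷ (8F , false) ∷ []))
    in t₀ , t₁ , t₄ , t₅ , agrees-everywhere λ where
      0F → at₀ (refl , refl , refl)
      1F → at₁ (refl , refl , refl)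
      2F → agrees-at-degree-2 (listsDartsAt G₃ 2F ((0F , true) ∷ (1F , false) ∷ [])) refl refl
      3F → agrees-at-degree-2 (listsDartsAt G₃ 3F ((1F , true) ∷ (2F , false) ∷ [])) refl refl
      4F → at₄ (refl , refl , refl)
      5F → at₅ (refl , refl , refl)
      6F → agrees-at-leaf (listsDartsAt G₃ 6F ((7F , true) ∷ [])) refl
      7F → agrees-at-leaf (listsDartsAt G₃ 7F ((8F , true) ∷ [])) refl

opaque
  unfolding orbitRoot

  orbitDual₁-twoLoopsAtTripleEdge : ∀ t₀ t₁ t₂ → TwoLoopsAtTripleEdge (orbitDual G₁ (rotation₁ t₀ t₁ t₂))
  orbitDual₁-twoLoopsAtTripleEdge = from-yes (∀-Bool? λ t₀ → ∀-Bool? λ t₁ → ∀-Bool? λ t₂ →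
    twoLoopsAtTripleEdge? (orbitDual G₁ (rotation₁ t₀ t₁ t₂)) _≟ᵈ_)

  rotation₃-dichotomy : ∀ t₀ t₁ t₄ t₅ →
    (∀ d → orbitRoot G₃ (rotation₃ t₀ t₁ t₄ t₅) d ≡ (0F , false)) ⊎
    (OrbitRootInvariant G₃ (rotation₃ t₀ t₁ t₄ t₅) ×
     ¬ TwoLoopsAtTripleEdge (orbitDual G₃ (rotation₃ t₀ t₁ t₄ t₅)))
  rotation₃-dichotomy = from-yes (∀-Bool? λ t₀ → ∀-Bool? λ t₁ → ∀-Bool? λ t₄ → ∀-Bool? λ t₅ →
    dichotomy? (rotation₃ t₀ t₁ t₄ t₅))
    where
    dichotomy? : ∀ r → Dec ((∀ d → orbitRoot G₃ r d ≡ (0F , false)) ⊎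
                            (OrbitRootInvariant G₃ r × ¬ TwoLoopsAtTripleEdge (orbitDual G₃ r)))
    dichotomy? r =
      allDarts? (λ d → orbitRoot G₃ r d ≟ᵈ (0F , false)) ⊎-dec
      (allDarts? (λ d → orbitRoot G₃ r (faceStep G₃ r d) ≟ᵈ orbitRoot G₃ r d) ×-dec
       ¬? (twoLoopsAtTripleEdge? (orbitDual G₃ r) _≟ᵈ_))

dual₁-twoLoopsAtTripleEdge : (P : PlanarEmbedding G₁) → TwoLoopsAtTripleEdge (ends (dual G₁ P))
dual₁-twoLoopsAtTripleEdge P with rotation₁-complete P
... | t₀ , t₁ , t₂ , σ≗r =
  transport (OrbitFaces.orbitDual⇒dual P σ≗r) (orbitDual₁-twoLoopsAtTripleEdge t₀ t₁ t₂)

three-faces : (P : PlanarEmbedding G₃) → F P ≡ 3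
three-faces P = +-cancelˡ-≡ 8 (F P) 3 (euler P)

dual₃-no-twoLoopsAtTripleEdge : (P : PlanarEmbedding G₃) → ¬ TwoLoopsAtTripleEdge (ends (dual G₃ P))
dual₃-no-twoLoopsAtTripleEdge P with rotation₃-complete P
... | t₀ , t₁ , t₄ , t₅ , σ≗r with rotation₃-dichotomy t₀ t₁ t₄ t₅
...   | inj₁ single-orbit = contradiction
          (subst (_≤ 1) (three-faces P)
                 (OrbitFaces.single-orbit⇒F≤1 P σ≗r (face-surjective P λ ()) single-orbit))
          λ { (s≤s ()) }
...   | inj₂ (invariant , none) =
          none ∘ transport (OrbitFaces.dual⇒orbitDual P σ≗r invariant (face-surjective P λ ()))

G₁≁G₃ : ¬ (G₁ ∼ G₃)
G₁≁G₃ (P₁ , P₃ , iso) =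
  dual₃-no-twoLoopsAtTripleEdge P₃ (transport (Iso⇒EdgeHom iso) (dual₁-twoLoopsAtTripleEdge P₁))

theorem9 : Σ Graph λ G₁ → Σ Graph λ G₂ → Σ Graph λ G₃ →
    (Connected G₁ × Connected G₂ × Connected G₃) ×
    (Planar G₁ × Planar G₂ × Planar G₃) ×
    (G₁ ∼ G₂) × (G₂ ∼ G₃) × ¬ (G₁ ∼ G₃)
theorem9 = G₁ , G₂ , G₃ ,
  (connected-via 0F reach-0₁ , connected-via 0F reach-0₂ , connected-via 0F reach-0₃) ,
  (embedding₁ , embedding₂ , embedding₃) ,
  G₁∼G₂ , G₂∼G₃ , G₁≁G₃
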